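{- Let $D$ be a multidigraph. Then an edge $e$ of $D$ is a simplicial edge of $D$ if and only if $e$ is a simplicial vertex of the tree conflict hypergraph $\mathcal{H}^{\mathbf{t}}_D$.
   Context: A multidigraph $D$ consists of finite sets $V(D)$, $E(D)$ and maps $s,t:E(D)\to V(D)$ (source, target). Edges $e\ne f$ are parallel if $s(e)=s(f)$ and $t(e)=t(f)$. For $\sigma\subseteq E(D)$, $D[\sigma]$ is the multidigraph with edge set $\sigma$ and vertex set $V(D[\sigma])$ the endpoints of edges of $\sigma$. A directed cycle is a connected multidigraph without parallel edges in which every vertex has in-degree and out-degree $1$. An edge $e$ is non-simplicial in $D$ if there exist an edge $f\in E(D)$ with $t(e)=t(f)$ and $s(e)\ne s(f)$, and a set $\sigma\subseteq E(D)$ with $e\in\sigma$ and $D[\sigma]$ a directed cycle, such that $s(f)\notin V(D[\sigma])$; otherwise $e$ is a simplicial edge of $D$. The tree conflict hypergraph $\mathcal{H}^{\mathbf{t}}_D$ has vertex set $E(D)$ and hyperedges: all $\sigma\subseteq E(D)$ with $D[\sigma]$ a directed cycle; all pairs $\{e,f\}$ of parallel edges; all pairs $\{e,f\}$ with $s(e)\ne s(f)$ and $t(e)=t(f)$. A vertex $v$ of a hypergraph is simplicial if for any two distinct hyperedges $h_1,h_2$ containing $v$ there is a hyperedge $h_3\subseteq(h_1\cup h_2)\setminus\{v\}$. -}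

module Defs where

open import Data.Nat using (ℕ)
open import Data.Fin using (Fin)
open import Data.Fin.Subset using (Subset; _∈_; _∉_; _⊆_; _∪_; _-_; ⁅_⁆)
open import Data.Product using (Σ; ∃; ∃-syntax; _×_; _,_)
open import Data.Sum using (_⊎_)
open import Relation.Nullary using (¬_)
open import Relation.Binary.PropositionalEquality using (_≡_; _≢_)
open import Relation.Binary.Construct.Closure.ReflexiveTransitive using (Star)

record Multidigraph : Set where
  field
    nV : ℕ
    nE : ℕ
    s  : Fin nE → Fin nV
    t  : Fin nE → Fin nV

module _ (D : Multidigraph) where
  open Multidigraph D

  Edge : Set
  Edge = Fin nE

  Vertex : Set
  Vertex = Fin nV

  Parallel : Edge → Edge → Set
  Parallel e f = e ≢ f × s e ≡ s f × t e ≡ t f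

  -- v ∈ V(D[σ]) : v is an endpoint of some edge of σ
  InV : Subset nE → Vertex → Set
  InV σ v = ∃[ e ] (e ∈ σ × (s e ≡ v ⊎ t e ≡ v))

  Adj : Subset nE → Vertex → Vertex → Set
  Adj σ u v = ∃[ e ] (e ∈ σ × ((s e ≡ u × t e ≡ v) ⊎ (s e ≡ v × t e ≡ u)))

  Connected : Subset nE → Set
  Connected σ = (∃[ e ] e ∈ σ)
              × (∀ u v → InV σ u → InV σ v → Star (Adj σ) u v)

  NoParallel : Subset nE → Set
  NoParallel σ = ∀ e f → e ∈ σ → f ∈ σ → ¬ Parallel e f

  InDegOne : Subset nE → Set
  InDegOne σ = ∀ v → InV σ v →
      (∃[ e ] (e ∈ σ × t e ≡ v))
    × (∀ e f → e ∈ σ → f ∈ σ → t e ≡ v → t f ≡ v → e ≡ f)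

  OutDegOne : Subset nE → Set
  OutDegOne σ = ∀ v → InV σ v →
      (∃[ e ] (e ∈ σ × s e ≡ v))
    × (∀ e f → e ∈ σ → f ∈ σ → s e ≡ v → s f ≡ v → e ≡ f)

  IsDirCycle : Subset nE → Set
  IsDirCycle σ = Connected σ × NoParallel σ × InDegOne σ × OutDegOne σ

  NonSimplicialEdge : Edge → Set
  NonSimplicialEdge e =
    ∃[ f ] (t e ≡ t f × s e ≢ s f
      × ∃[ σ ] (e ∈ σ × IsDirCycle σ × ¬ InV σ (s f)))

  SimplicialEdge : Edge → Set
  SimplicialEdge e = ¬ NonSimplicialEdge e

  TreeConflictHyperedge : Subset nE → Set
  TreeConflictHyperedge h =
      IsDirCycle h
    ⊎ (∃[ e ] ∃[ f ] (Parallel e f × h ≡ ⁅ e ⁆ ∪ ⁅ f ⁆))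
    ⊎ (∃[ e ] ∃[ f ] (s e ≢ s f × t e ≡ t f × h ≡ ⁅ e ⁆ ∪ ⁅ f ⁆))

SimplicialVertexOf : {n : ℕ} → (Subset n → Set) → Fin n → Set
SimplicialVertexOf {n} IsHyp v =
  ∀ (h₁ h₂ : Subset n) → IsHyp h₁ → IsHyp h₂ → h₁ ≢ h₂ → v ∈ h₁ → v ∈ h₂ →
    ∃[ h₃ ] (IsHyp h₃ × h₃ ⊆ (h₁ ∪ h₂) - v)

{-# OPTIONS --safe #-}
-- Let C be a directed cycle through e and f ≠ e an edge with the same head. In the exchanged
-- edge set (C − e) ∪ {f} every vertex still has at most one in-edge, so it contains no pair
-- hyperedge, and it contains a directed cycle exactly when the tail of f lies on C: if it does,
-- every vertex has in-degree one and following in-edges backwards closes a cycle; if it does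
-- not, a cycle would have to avoid f, so it would lie in C − e, contradicting the minimality of
-- the directed cycle C. As (C ∪ {e, f}) − e is the exchanged set, the hyperedges C and {e, f}
-- admit a third one avoiding e iff s(f) ∈ V(C), which is the simpliciality of e. Every other
-- pair of hyperedges through e admits one: {e, f₁}, {e, f₂} give {f₁, f₂}, and two distinct
-- cycles through e contain distinct edges with a common head, for otherwise each would be
-- contained in the other.
module Submission where

open import Defs
open import Data.Empty using (⊥-elim)
open import Data.Fin using (Fin; toℕ)
open import Data.Fin.Properties using (pigeonhole; any?) renaming (_≟_ to _≟ᶠ_)
open import Data.Fin.Subset using (Subset; Nonempty; _∈_; _∉_; _⊆_; _∪_; _─_; _-_; ⁅_⁆; outside)
open import Data.Fin.Subset.Properties using (_∈?_; x∈⁅x⁆; x∈⁅y⁆⇒x≡y; x∈p∪q⁻; x∈p∪q⁺; p─q⊆p; x∈p∧x≢y⇒x∈p-y; ∪-comm; ⊆-antisym)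
open import Data.Nat using (ℕ; zero; suc; _+_; _≤_; _<_; z≤n; s≤s⁻¹)
open import Data.Nat.Induction using (<-rec)
open import Data.Nat.Properties using (≤-refl; <⇒≤; m≤n⇒m≤1+n; m≤n⇒m<n∨m≡n; m≤n⇒∃[o]m+o≡n; +-comm; +-suc; +-monoʳ-<; <-cmp; anyUpTo?)
open import Data.Product using (∃₂; ∃-syntax; _×_; _,_; proj₁; proj₂)
open import Data.Sum using (_⊎_; inj₁; inj₂; swap)
open import Data.Vec using (_∷_; here; there)
open import Function using (_∘_; id)
open import Function.Bundles using (_⇔_; mk⇔)
open import Function.Definitions using (Injective)
import Function.Endo.Propositional as Endo
open import Relation.Binary.Construct.Closure.ReflexiveTransitive using (Star; ε; _◅_; _◅◅_; reverse)
open import Relation.Binary.Definitions using (tri<; tri≈; tri>)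
open import Relation.Binary.PropositionalEquality using (_≡_; _≢_; refl; sym; trans; cong; cong-app; subst; module ≡-Reasoning)
open import Relation.Nullary using (¬_; Dec; yes; no)
open import Relation.Nullary.Decidable using (_×-dec_; _⊎-dec_; ¬?; decidable-stable)
open import Relation.Unary using (Decidable)

least-witness : ∀ {P : ℕ → Set} → Decidable P → ∀ {n} → P n →
                ∃[ m ] (P m × (∀ {j} → j < m → ¬ P j))
least-witness {P} P? {n} = <-rec (λ n → P n → ∃[ m ] (P m × (∀ {j} → j < m → ¬ P j))) search n
  where
  search : ∀ n → (∀ {m} → m < n → P m → ∃[ m ] (P m × (∀ {j} → j < m → ¬ P j))) →
           P n → ∃[ m ] (P m × (∀ {j} → j < m → ¬ P j))
  search n smaller Pn with anyUpTo? P? n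
  ... | yes (m , m<n , Pm) = smaller m<n Pm
  ... | no none            = n , Pn , λ j<n Pj → none (_ , j<n , Pj)

module _ {n : ℕ} (f : Fin n → Fin n) where
  open Endo (Fin n) using (_^_; ^-homo)

  Periodic : Fin n → Set
  Periodic x = ∃[ k ] ((f ^ suc k) x ≡ x)

  ^-+ : ∀ m k x → (f ^ (m + k)) x ≡ (f ^ m) ((f ^ k) x)
  ^-+ m k = cong-app (^-homo f m k)

  ^-suc′ : ∀ k x → (f ^ suc k) x ≡ (f ^ k) (f x)
  ^-suc′ k x = trans (cong (λ m → (f ^ m) x) (+-comm 1 k)) (^-+ k 1 x)

  ^-comm : ∀ m k x → (f ^ m) ((f ^ k) x) ≡ (f ^ k) ((f ^ m) x)
  ^-comm m k x = begin
    (f ^ m) ((f ^ k) x) ≡⟨ ^-+ m k x ⟨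
    (f ^ (m + k)) x     ≡⟨ cong (λ j → (f ^ j) x) (+-comm m k) ⟩
    (f ^ (k + m)) x     ≡⟨ ^-+ k m x ⟩
    (f ^ k) ((f ^ m) x) ∎
    where open ≡-Reasoning

  ^-preserves : ∀ {P : Fin n → Set} → (∀ {x} → P x → P (f x)) → ∀ k {x} → P x → P ((f ^ k) x)
  ^-preserves         step zero    Px = Px
  ^-preserves {P = P} step (suc k) Px = step (^-preserves {P = P} step k Px)

  ^-injective : Injective _≡_ _≡_ f → ∀ k → Injective _≡_ _≡_ (f ^ k)
  ^-injective inj zero    eq = eq
  ^-injective inj (suc k) {x} {y} eq = ^-injective inj k {x} {y} (inj eq)

  eventually-periodic : ∀ x → ∃[ i ] Periodic ((f ^ i) x)
  eventually-periodic x with pigeonhole ≤-refl (λ i → (f ^ toℕ i) x)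
  ... | i , j , i<j , fⁱx≡fʲx with m≤n⇒∃[o]m+o≡n i<j
  ... | k , 1+i+k≡j = toℕ i , k , (begin
    (f ^ suc k) ((f ^ toℕ i) x) ≡⟨ ^-+ (suc k) (toℕ i) x ⟨
    (f ^ (suc k + toℕ i)) x     ≡⟨ cong (λ m → (f ^ m) x) (trans (cong suc (+-comm k (toℕ i))) 1+i+k≡j) ⟩
    (f ^ toℕ j) x               ≡⟨ fⁱx≡fʲx ⟨
    (f ^ toℕ i) x               ∎)
    where open ≡-Reasoning

  injective⇒periodic : Injective _≡_ _≡_ f → ∀ x → Periodic x
  injective⇒periodic inj x with eventually-periodic x
  ... | i , k , per = k , ^-injective inj i {(f ^ suc k) x} {x} (trans (^-comm i (suc k) x) per)

  least-period : ∀ {x} → Periodic x →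
                 ∃[ p ] ((f ^ suc p) x ≡ x × (∀ {j} → j < p → (f ^ suc j) x ≢ x))
  least-period {x} (k , per) =
    least-witness {λ j → (f ^ suc j) x ≡ x} (λ j → (f ^ suc j) x ≟ᶠ x) {k} per

  least-period⇒distinct : ∀ {y p} → (f ^ suc p) y ≡ y → (∀ {j} → j < p → (f ^ suc j) y ≢ y) →
                          ∀ {i j} → i < j → j ≤ p → (f ^ suc i) y ≢ (f ^ suc j) y
  least-period⇒distinct {y} {p} period least {i} {j} i<j j≤p eq with m≤n⇒∃[o]m+o≡n j≤p
  ... | r , j+r≡p = least r+i<p (begin
    (f ^ suc (r + i)) y        ≡⟨ cong (λ m → (f ^ m) y) (+-suc r i) ⟨
    (f ^ (r + suc i)) y        ≡⟨ ^-+ r (suc i) y ⟩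
    (f ^ r) ((f ^ suc i) y)    ≡⟨ cong (f ^ r) eq ⟩
    (f ^ r) ((f ^ suc j) y)    ≡⟨ ^-+ r (suc j) y ⟨
    (f ^ (r + suc j)) y        ≡⟨ cong (λ m → (f ^ m) y) (trans (+-suc r j) (cong suc (trans (+-comm r j) j+r≡p))) ⟩
    (f ^ suc p) y              ≡⟨ period ⟩
    y                          ∎)
    where
    open ≡-Reasoning
    r+i<p : r + i < p
    r+i<p = subst (r + i <_) (trans (+-comm r j) j+r≡p) (+-monoʳ-< r i<j)

x∈p─q⇒x∉q : ∀ {n} {x : Fin n} (p q : Subset n) → x ∈ p ─ q → x ∉ q
x∈p─q⇒x∉q (_ ∷ _) (outside ∷ _) here ()
x∈p─q⇒x∉q (_ ∷ p) (_ ∷ q) (there x∈p─q) (there x∈q) = x∈p─q⇒x∉q p q x∈p─q x∈q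

module _ {n : ℕ} where

  x∈p-y⇒x≢y : ∀ (p : Subset n) {x y} → x ∈ p - y → x ≢ y
  x∈p-y⇒x≢y p {y = y} x∈p-y refl = x∈p─q⇒x∉q p ⁅ y ⁆ x∈p-y (x∈⁅x⁆ y)

  x∈⁅y⁆∪⁅z⁆⇒x≡y⊎x≡z : ∀ {x y z : Fin n} → x ∈ ⁅ y ⁆ ∪ ⁅ z ⁆ → x ≡ y ⊎ x ≡ z
  x∈⁅y⁆∪⁅z⁆⇒x≡y⊎x≡z {y = y} {z} x∈ with x∈p∪q⁻ ⁅ y ⁆ ⁅ z ⁆ x∈
  ... | inj₁ x∈⁅y⁆ = inj₁ (x∈⁅y⁆⇒x≡y y x∈⁅y⁆)
  ... | inj₂ x∈⁅z⁆ = inj₂ (x∈⁅y⁆⇒x≡y z x∈⁅z⁆)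

  x∈⁅x⁆∪⁅y⁆ : ∀ (x y : Fin n) → x ∈ ⁅ x ⁆ ∪ ⁅ y ⁆
  x∈⁅x⁆∪⁅y⁆ x y = x∈p∪q⁺ (inj₁ (x∈⁅x⁆ x))

  y∈⁅x⁆∪⁅y⁆ : ∀ (x y : Fin n) → y ∈ ⁅ x ⁆ ∪ ⁅ y ⁆
  y∈⁅x⁆∪⁅y⁆ x y = x∈p∪q⁺ (inj₂ (x∈⁅x⁆ y))

  ⁅x⁆∪⁅y⁆⊆p : ∀ {x y : Fin n} {p} → x ∈ p → y ∈ p → ⁅ x ⁆ ∪ ⁅ y ⁆ ⊆ p
  ⁅x⁆∪⁅y⁆⊆p x∈p y∈p z∈ with x∈⁅y⁆∪⁅z⁆⇒x≡y⊎x≡z z∈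
  ... | inj₁ refl = x∈p
  ... | inj₂ refl = y∈p

  image : (ℕ → Fin n) → ℕ → Subset n
  image h zero    = ⁅ h zero ⁆
  image h (suc k) = ⁅ h (suc k) ⁆ ∪ image h k

  ∈-image⁺ : ∀ (h : ℕ → Fin n) {j k} → j ≤ k → h j ∈ image h k
  ∈-image⁺ h {k = zero} z≤n = x∈⁅x⁆ _
  ∈-image⁺ h {k = suc k} j≤1+k with m≤n⇒m<n∨m≡n j≤1+k
  ... | inj₁ j<1+k = x∈p∪q⁺ (inj₂ (∈-image⁺ h (s≤s⁻¹ j<1+k)))
  ... | inj₂ refl  = x∈p∪q⁺ (inj₁ (x∈⁅x⁆ _))

  ∈-image⁻ : ∀ (h : ℕ → Fin n) {k x} → x ∈ image h k → ∃[ j ] (j ≤ k × x ≡ h j)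
  ∈-image⁻ h {zero} x∈ = zero , z≤n , x∈⁅y⁆⇒x≡y (h zero) x∈
  ∈-image⁻ h {suc k} x∈ with x∈p∪q⁻ ⁅ h (suc k) ⁆ (image h k) x∈
  ... | inj₁ x∈⁅h⁆ = suc k , ≤-refl , x∈⁅y⁆⇒x≡y (h (suc k)) x∈⁅h⁆
  ... | inj₂ x∈img with ∈-image⁻ h x∈img
  ...   | j , j≤k , x≡hj = j , m≤n⇒m≤1+n j≤k , x≡hj

  x∈p∪q∧x≢y⇒x∈p∪q-y : ∀ {p q} {x y : Fin n} → x ∈ p ⊎ x ∈ q → x ≢ y → x ∈ (p ∪ q) - y
  x∈p∪q∧x≢y⇒x∈p∪q-y x∈p⊎x∈q = x∈p∧x≢y⇒x∈p-y (x∈p∪q⁺ x∈p⊎x∈q)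

  exchange : Subset n → Fin n → Fin n → Subset n
  exchange p x y = (p - x) ∪ ⁅ y ⁆

  ∈-exchange⁻ : ∀ {p} {x y z : Fin n} → z ∈ exchange p x y → (z ∈ p × z ≢ x) ⊎ z ≡ y
  ∈-exchange⁻ {p} {x} {y} z∈ with x∈p∪q⁻ (p - x) ⁅ y ⁆ z∈
  ... | inj₁ z∈p-x = inj₁ (p─q⊆p p ⁅ x ⁆ z∈p-x , x∈p-y⇒x≢y p z∈p-x)
  ... | inj₂ z∈⁅y⁆ = inj₂ (x∈⁅y⁆⇒x≡y y z∈⁅y⁆)

  ∈-exchange⁺ : ∀ {p} {x y z : Fin n} → z ∈ p → z ≢ x → z ∈ exchange p x y
  ∈-exchange⁺ z∈p z≢x = x∈p∪q⁺ (inj₁ (x∈p∧x≢y⇒x∈p-y z∈p z≢x))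

  x∉exchange : ∀ {p} {x y : Fin n} → y ≢ x → x ∉ exchange p x y
  x∉exchange y≢x x∈ with ∈-exchange⁻ x∈
  ... | inj₁ (_ , x≢x) = x≢x refl
  ... | inj₂ x≡y       = y≢x (sym x≡y)

  y∈exchange : ∀ {p} {x y : Fin n} → y ∈ exchange p x y
  y∈exchange {y = y} = x∈p∪q⁺ (inj₂ (x∈⁅x⁆ y))

  p∪⁅x⁆∪⁅y⁆-x≡exchange : ∀ {p} {x y : Fin n} → y ≢ x → (p ∪ (⁅ x ⁆ ∪ ⁅ y ⁆)) - x ≡ exchange p x y
  p∪⁅x⁆∪⁅y⁆-x≡exchange {p} {x} {y} y≢x = ⊆-antisym ⊆exchange exchange⊆
    where
    ⊆exchange : (p ∪ (⁅ x ⁆ ∪ ⁅ y ⁆)) - x ⊆ exchange p x y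
    ⊆exchange z∈ with x∈p∪q⁻ p _ (p─q⊆p _ ⁅ x ⁆ z∈) | x∈p-y⇒x≢y _ z∈
    ... | inj₁ z∈p   | z≢x = ∈-exchange⁺ z∈p z≢x
    ... | inj₂ z∈x,y | z≢x with x∈⁅y⁆∪⁅z⁆⇒x≡y⊎x≡z z∈x,y
    ...   | inj₁ refl = ⊥-elim (z≢x refl)
    ...   | inj₂ refl = y∈exchange
    exchange⊆ : exchange p x y ⊆ (p ∪ (⁅ x ⁆ ∪ ⁅ y ⁆)) - x
    exchange⊆ z∈ with ∈-exchange⁻ z∈
    ... | inj₁ (z∈p , z≢x) = x∈p∧x≢y⇒x∈p-y (x∈p∪q⁺ (inj₁ z∈p)) z≢x
    ... | inj₂ refl        = x∈p∧x≢y⇒x∈p-y (x∈p∪q⁺ (inj₂ (y∈⁅x⁆∪⁅y⁆ x y))) y≢x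

module _ (D : Multidigraph) where
  open Multidigraph D
  open Endo (Vertex D) using (_^_)

  InV? : ∀ σ v → Dec (InV D σ v)
  InV? σ v = any? λ g → (g ∈? σ) ×-dec ((s g ≟ᶠ v) ⊎-dec (t g ≟ᶠ v))

  mkInDegOne : ∀ {σ} → (∀ v → InV D σ v → ∃[ g ] (g ∈ σ × t g ≡ v)) →
               (∀ {a b} → a ∈ σ → b ∈ σ → t a ≡ t b → a ≡ b) → InDegOne D σ
  mkInDegOne in-edge in-unique v v∈ =
    in-edge v v∈ , λ a b a∈ b∈ ta≡v tb≡v → in-unique a∈ b∈ (trans ta≡v (sym tb≡v))

  in-edge : ∀ {σ v} → InDegOne D σ → InV D σ v → ∃[ g ] (g ∈ σ × t g ≡ v)
  in-edge in₁ v∈ = proj₁ (in₁ _ v∈)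

  in-unique : ∀ {σ} → InDegOne D σ → ∀ {a b} → a ∈ σ → b ∈ σ → t a ≡ t b → a ≡ b
  in-unique in₁ {a} a∈ b∈ ta≡tb = proj₂ (in₁ (t a) (a , a∈ , inj₂ refl)) _ _ a∈ b∈ refl (sym ta≡tb)

  out-unique : ∀ {σ} → OutDegOne D σ → ∀ {a b} → a ∈ σ → b ∈ σ → s a ≡ s b → a ≡ b
  out-unique out₁ {a} a∈ b∈ sa≡sb = proj₂ (out₁ (s a) (a , a∈ , inj₁ refl)) _ _ a∈ b∈ refl (sym sa≡sb)

  cycle⇒InDegOne : ∀ {σ} → IsDirCycle D σ → InDegOne D σ
  cycle⇒InDegOne (_ , _ , in₁ , _) = in₁

  cycle⇒OutDegOne : ∀ {σ} → IsDirCycle D σ → OutDegOne D σ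
  cycle⇒OutDegOne (_ , _ , _ , out₁) = out₁

  module Predecessor {σ} (in₁ : InDegOne D σ) where

    -- Off V(D[σ]) the predecessor map is the identity, which keeps it total.
    predecessor : Vertex D → Vertex D
    predecessor v with InV? σ v
    ... | yes v∈ = s (proj₁ (in-edge in₁ v∈))
    ... | no  _  = v

    predecessor-t : ∀ {g} → g ∈ σ → predecessor (t g) ≡ s g
    predecessor-t {g} g∈ with InV? σ (t g)
    ... | yes tg∈ = cong s (in-unique in₁ (proj₁ (proj₂ (in-edge in₁ tg∈))) g∈ (proj₂ (proj₂ (in-edge in₁ tg∈))))
    ... | no  tg∉ = ⊥-elim (tg∉ (g , g∈ , inj₂ refl))

    predecessor-outside : ∀ {v} → ¬ InV D σ v → predecessor v ≡ v
    predecessor-outside {v} v∉ with InV? σ v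
    ... | yes v∈ = ⊥-elim (v∉ v∈)
    ... | no  _  = refl

    predecessor-InV : ∀ {v} → InV D σ v → InV D σ (predecessor v)
    predecessor-InV v∈ with in-edge in₁ v∈
    ... | g , g∈ , refl = g , g∈ , inj₁ (sym (predecessor-t g∈))

    predecessor-injective : OutDegOne D σ → Injective _≡_ _≡_ predecessor
    -- A fresh decision is split on: `with InV? σ v` would also abstract it inside `predecessor v`.
    predecessor-injective out₁ {v} {w} eq = by-cases (InV? σ v) (InV? σ w)
      where
      by-cases : Dec (InV D σ v) → Dec (InV D σ w) → v ≡ w
      by-cases (yes v∈) (yes w∈) with in-edge in₁ v∈ | in-edge in₁ w∈
      ... | a , a∈ , refl | b , b∈ , refl =
        cong t (out-unique out₁ a∈ b∈ (trans (sym (predecessor-t a∈)) (trans eq (predecessor-t b∈))))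
      by-cases (yes v∈) (no w∉) =
        ⊥-elim (w∉ (subst (InV D σ) (trans eq (predecessor-outside w∉)) (predecessor-InV v∈)))
      by-cases (no v∉) (yes w∈) =
        ⊥-elim (v∉ (subst (InV D σ) (trans (sym eq) (predecessor-outside v∉)) (predecessor-InV w∈)))
      by-cases (no v∉) (no w∉) =
        trans (sym (predecessor-outside v∉)) (trans eq (predecessor-outside w∉))

  BackwardClosed : Subset nE → (Vertex D → Set) → Set
  BackwardClosed σ X = ∀ {g} → g ∈ σ → X (t g) → X (s g)

  module _ {σ} (cyc : IsDirCycle D σ) {X : Vertex D → Set} (closed : BackwardClosed σ X) where
    private
      in₁ = cycle⇒InDegOne cyc
    open Predecessor in₁

    predecessor-closed : ∀ {v} → X v → X (predecessor v)
    predecessor-closed {v} Xv = by-cases (InV? σ v)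
      where
      by-cases : Dec (InV D σ v) → X (predecessor v)
      by-cases (no v∉) = subst X (sym (predecessor-outside v∉)) Xv
      by-cases (yes v∈) with in-edge in₁ v∈
      ... | g , g∈ , refl = subst X (sym (predecessor-t g∈)) (closed g∈ Xv)

    -- The predecessor map permutes the vertices, so going backward around
    -- the cycle from s g eventually reaches t g.
    backwardClosed⇒forwardClosed : ∀ {g} → g ∈ σ → X (s g) → X (t g)
    backwardClosed⇒forwardClosed {g} g∈ Xsg
      with injective⇒periodic predecessor (predecessor-injective (cycle⇒OutDegOne cyc)) (t g)
    ... | k , period = subst X period (subst X (sym (^-suc′ predecessor k (t g)))
                         (^-preserves predecessor {X} predecessor-closed k (subst X (sym (predecessor-t g∈)) Xsg)))

    backwardClosed⇒all : ∀ {u v} → InV D σ u → X u → InV D σ v → X v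
    backwardClosed⇒all u∈ Xu v∈ = along (proj₂ (proj₁ cyc) _ _ u∈ v∈) Xu
      where
      along : ∀ {u v} → Star (Adj D σ) u v → X u → X v
      along ε                                    = id
      along ((g , g∈ , inj₁ (refl , refl)) ◅ w) = along w ∘ backwardClosed⇒forwardClosed g∈
      along ((g , g∈ , inj₂ (refl , refl)) ◅ w) = along w ∘ closed g∈

  cycle-⊆ : ∀ {C C′ u} → IsDirCycle D C → IsDirCycle D C′ →
            (∀ {g g′} → g ∈ C → g′ ∈ C′ → t g ≡ t g′ → g ≡ g′) →
            InV D C u → InV D C′ u → C ⊆ C′
  cycle-⊆ {C} {C′} cyc cyc′ agree u∈C u∈C′ g∈ =
    adopt g∈ (backwardClosed⇒all cyc closed u∈C u∈C′ (_ , g∈ , inj₂ refl))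
    where
    adopt : ∀ {g} → g ∈ C → InV D C′ (t g) → g ∈ C′
    adopt g∈ tg∈ with in-edge (cycle⇒InDegOne cyc′) tg∈
    ... | g′ , g′∈ , tg′≡tg = subst (_∈ C′) (sym (agree g∈ g′∈ (sym tg′≡tg))) g′∈
    closed : BackwardClosed C (InV D C′)
    closed g∈ tg∈ = _ , adopt g∈ tg∈ , inj₁ refl

  cycle-minimal : ∀ {C C′} → IsDirCycle D C → IsDirCycle D C′ → C′ ⊆ C → C ⊆ C′
  cycle-minimal cyc cyc′ C′⊆C with proj₁ (proj₁ cyc′)
  ... | g₀ , g₀∈ = cycle-⊆ cyc cyc′ (λ g∈ g′∈ → in-unique (cycle⇒InDegOne cyc) g∈ (C′⊆C g′∈))
                     (g₀ , C′⊆C g₀∈ , inj₂ refl) (g₀ , g₀∈ , inj₂ refl)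

  module _ {σ} (in₁ : InDegOne D σ) where
    open Predecessor in₁

    module Orbit {y} (y∈ : InV D σ y) (p : ℕ) (period : (predecessor ^ suc p) y ≡ y)
                 (least : ∀ {j} → j < p → (predecessor ^ suc j) y ≢ y) where

      orbit : ℕ → Vertex D
      orbit j = (predecessor ^ j) y

      orbit∈ : ∀ j → InV D σ (orbit j)
      orbit∈ j = ^-preserves predecessor {InV D σ} predecessor-InV j y∈

      edge : ℕ → Edge D
      edge j = proj₁ (in-edge in₁ (orbit∈ j))

      edge∈σ : ∀ j → edge j ∈ σ
      edge∈σ j = proj₁ (proj₂ (in-edge in₁ (orbit∈ j)))

      t-edge : ∀ j → t (edge j) ≡ orbit j
      t-edge j = proj₂ (proj₂ (in-edge in₁ (orbit∈ j)))

      s-edge : ∀ j → s (edge j) ≡ orbit (suc j)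
      s-edge j = trans (sym (predecessor-t (edge∈σ j))) (cong predecessor (t-edge j))

      Z : Subset nE
      Z = image edge p

      Z⊆σ : Z ⊆ σ
      Z⊆σ g∈ with ∈-image⁻ edge {p} g∈
      ... | j , _ , refl = edge∈σ j

      edge∈Z : ∀ {j} → j ≤ p → edge j ∈ Z
      edge∈Z = ∈-image⁺ edge

      vertex-of-Z : ∀ {v} → InV D Z v → ∃[ j ] (j ≤ p × orbit j ≡ v)
      vertex-of-Z (g , g∈ , end) with ∈-image⁻ edge {p} g∈
      ... | j , j≤p , refl with end
      ...   | inj₂ tg≡v = j , j≤p , trans (sym (t-edge j)) tg≡v
      ...   | inj₁ sg≡v with m≤n⇒m<n∨m≡n j≤p
      ...     | inj₁ j<p  = suc j , j<p , trans (sym (s-edge j)) sg≡v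
      ...     | inj₂ refl = zero , z≤n , trans (sym period) (trans (sym (s-edge j)) sg≡v)

      walk : ∀ {j} → j ≤ p → Star (Adj D Z) y (orbit j)
      walk {zero}  _   = ε
      walk {suc j} j<p = walk (<⇒≤ j<p) ◅◅ ((edge j , edge∈Z (<⇒≤ j<p) , inj₂ (s-edge j , t-edge j)) ◅ ε)

      s-edge-injective : ∀ {i j} → i ≤ p → j ≤ p → s (edge i) ≡ s (edge j) → i ≡ j
      s-edge-injective {i} {j} i≤p j≤p si≡sj with <-cmp i j
      ... | tri< i<j _ _ = ⊥-elim (least-period⇒distinct predecessor period least i<j j≤p
                                     (trans (sym (s-edge i)) (trans si≡sj (s-edge j))))
      ... | tri≈ _ i≡j _ = i≡j
      ... | tri> _ _ j<i = ⊥-elim (least-period⇒distinct predecessor period least j<i i≤p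
                                     (trans (sym (s-edge j)) (trans (sym si≡sj) (s-edge i))))

      connected : Connected D Z
      connected = (edge 0 , edge∈Z z≤n) , λ u v u∈ v∈ → join (vertex-of-Z u∈) (vertex-of-Z v∈)
        where
        join : ∀ {u v} → ∃[ i ] (i ≤ p × orbit i ≡ u) → ∃[ j ] (j ≤ p × orbit j ≡ v) → Star (Adj D Z) u v
        join (i , i≤p , refl) (j , j≤p , refl) =
          reverse (λ (g , g∈ , ends) → g , g∈ , swap ends) (walk i≤p) ◅◅ walk j≤p

      noParallel : NoParallel D Z
      noParallel a b a∈ b∈ (a≢b , _ , ta≡tb) = a≢b (in-unique in₁ (Z⊆σ a∈) (Z⊆σ b∈) ta≡tb)

      inDegOne : InDegOne D Z
      inDegOne v v∈ with vertex-of-Z v∈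
      ... | j , j≤p , refl = (edge j , edge∈Z j≤p , t-edge j) ,
                             λ a b a∈ b∈ ta≡v tb≡v → in-unique in₁ (Z⊆σ a∈) (Z⊆σ b∈) (trans ta≡v (sym tb≡v))

      outDegOne : OutDegOne D Z
      outDegOne v v∈ = out-edge (vertex-of-Z v∈) , unique
        where
        out-edge : ∃[ j ] (j ≤ p × orbit j ≡ v) → ∃[ g ] (g ∈ Z × s g ≡ v)
        out-edge (zero  , _   , refl) = edge p , edge∈Z ≤-refl , trans (s-edge p) period
        out-edge (suc j , j<p , refl) = edge j , edge∈Z (<⇒≤ j<p) , s-edge j
        unique : ∀ a b → a ∈ Z → b ∈ Z → s a ≡ v → s b ≡ v → a ≡ b
        unique a b a∈ b∈ sa≡v sb≡v with ∈-image⁻ edge {p} a∈ | ∈-image⁻ edge {p} b∈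
        ... | i , i≤p , refl | j , j≤p , refl = cong edge (s-edge-injective i≤p j≤p (trans sa≡v (sym sb≡v)))

      cycle : IsDirCycle D Z
      cycle = connected , noParallel , inDegOne , outDegOne

    InDegOne⇒cycle : Nonempty σ → ∃[ Z ] (Z ⊆ σ × IsDirCycle D Z)
    InDegOne⇒cycle (g₀ , g₀∈) with eventually-periodic predecessor (t g₀)
    ... | i , per with least-period predecessor per
    ... | p , period , least = O.Z , O.Z⊆σ , O.cycle
      where
      module O = Orbit (^-preserves predecessor {InV D σ} predecessor-InV i (g₀ , g₀∈ , inj₂ refl)) p period least

  HeadConflict : Edge D → Edge D → Set
  HeadConflict a b = a ≢ b × t a ≡ t b

  headConflict-sym : ∀ {a b} → HeadConflict a b → HeadConflict b a
  headConflict-sym (a≢b , ta≡tb) = a≢b ∘ sym , sym ta≡tb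

  headConflict⇒hyperedge : ∀ {a b} → HeadConflict a b → TreeConflictHyperedge D (⁅ a ⁆ ∪ ⁅ b ⁆)
  headConflict⇒hyperedge {a} {b} (a≢b , ta≡tb) with s a ≟ᶠ s b
  ... | yes sa≡sb = inj₂ (inj₁ (a , b , (a≢b , sa≡sb , ta≡tb) , refl))
  ... | no  sa≢sb = inj₂ (inj₂ (a , b , sa≢sb , ta≡tb , refl))

  hyperedge⇒cycle⊎headConflict : ∀ {h} → TreeConflictHyperedge D h →
    IsDirCycle D h ⊎ ∃₂ λ a b → HeadConflict a b × h ≡ ⁅ a ⁆ ∪ ⁅ b ⁆
  hyperedge⇒cycle⊎headConflict (inj₁ cyc) = inj₁ cyc
  hyperedge⇒cycle⊎headConflict (inj₂ (inj₁ (a , b , (a≢b , _ , ta≡tb) , h≡))) =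
    inj₂ (a , b , (a≢b , ta≡tb) , h≡)
  hyperedge⇒cycle⊎headConflict (inj₂ (inj₂ (a , b , sa≢sb , ta≡tb , h≡))) =
    inj₂ (a , b , ((λ { refl → sa≢sb refl }) , ta≡tb) , h≡)

  hyperedge-through : ∀ {h e} → TreeConflictHyperedge D h → e ∈ h →
    IsDirCycle D h ⊎ ∃[ f ] (HeadConflict e f × h ≡ ⁅ e ⁆ ∪ ⁅ f ⁆)
  hyperedge-through H e∈ with hyperedge⇒cycle⊎headConflict H
  ... | inj₁ cyc = inj₁ cyc
  ... | inj₂ (a , b , conflict , refl) with x∈⁅y⁆∪⁅z⁆⇒x≡y⊎x≡z e∈
  ...   | inj₁ refl = inj₂ (b , conflict , refl)
  ...   | inj₂ refl = inj₂ (a , headConflict-sym conflict , ∪-comm ⁅ a ⁆ ⁅ b ⁆)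

  HyperedgeIn : Subset nE → Set
  HyperedgeIn q = ∃[ h ] (TreeConflictHyperedge D h × h ⊆ q)

  headConflict⇒HyperedgeIn : ∀ {a b q} → HeadConflict a b → a ∈ q → b ∈ q → HyperedgeIn q
  headConflict⇒HyperedgeIn conflict a∈ b∈ = _ , headConflict⇒hyperedge conflict , ⁅x⁆∪⁅y⁆⊆p a∈ b∈

  distinct-cycles⇒headConflict : ∀ {C₁ C₂ v} → IsDirCycle D C₁ → IsDirCycle D C₂ → C₁ ≢ C₂ →
    InV D C₁ v → InV D C₂ v → ∃₂ λ g₁ g₂ → g₁ ∈ C₁ × g₂ ∈ C₂ × HeadConflict g₁ g₂
  distinct-cycles⇒headConflict {C₁} {C₂} cyc₁ cyc₂ C₁≢C₂ v∈₁ v∈₂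
    with any? (λ g₁ → any? (λ g₂ → (g₁ ∈? C₁) ×-dec (g₂ ∈? C₂) ×-dec ¬? (g₁ ≟ᶠ g₂) ×-dec (t g₁ ≟ᶠ t g₂)))
  ... | yes conflict = conflict
  ... | no  none     = ⊥-elim (C₁≢C₂ (⊆-antisym (cycle-⊆ cyc₁ cyc₂ agree v∈₁ v∈₂) (cycle-⊆ cyc₂ cyc₁ agree′ v∈₂ v∈₁)))
    where
    agree : ∀ {g₁ g₂} → g₁ ∈ C₁ → g₂ ∈ C₂ → t g₁ ≡ t g₂ → g₁ ≡ g₂
    agree {g₁} {g₂} g₁∈ g₂∈ tg₁≡tg₂ =
      decidable-stable (g₁ ≟ᶠ g₂) λ g₁≢g₂ → none (g₁ , g₂ , g₁∈ , g₂∈ , g₁≢g₂ , tg₁≡tg₂)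
    agree′ : ∀ {g₂ g₁} → g₂ ∈ C₂ → g₁ ∈ C₁ → t g₂ ≡ t g₁ → g₂ ≡ g₁
    agree′ g₂∈ g₁∈ tg₂≡tg₁ = sym (agree g₁∈ g₂∈ (sym tg₂≡tg₁))

  module Exchange {C e f} (cyc : IsDirCycle D C) (e∈C : e ∈ C) (conflict : HeadConflict e f) where
    private
      in₁ = cycle⇒InDegOne cyc
      tf≡te = sym (proj₂ conflict)

    exchange-in-unique : ∀ {a b} → a ∈ exchange C e f → b ∈ exchange C e f → t a ≡ t b → a ≡ b
    exchange-in-unique a∈ b∈ ta≡tb with ∈-exchange⁻ a∈ | ∈-exchange⁻ b∈
    ... | inj₁ (a∈C , _)   | inj₁ (b∈C , _)   = in-unique in₁ a∈C b∈C ta≡tb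
    ... | inj₁ (a∈C , a≢e) | inj₂ refl        = ⊥-elim (a≢e (in-unique in₁ a∈C e∈C (trans ta≡tb tf≡te)))
    ... | inj₂ refl        | inj₁ (b∈C , b≢e) = ⊥-elim (b≢e (in-unique in₁ b∈C e∈C (trans (sym ta≡tb) tf≡te)))
    ... | inj₂ refl        | inj₂ refl        = refl

    exchange-InDegOne : InV D C (s f) → InDegOne D (exchange C e f)
    exchange-InDegOne sf∈C = mkInDegOne in-edge′ exchange-in-unique
      where
      vertex-of-C : ∀ {v} → InV D (exchange C e f) v → InV D C v
      vertex-of-C (g , g∈ , end) with ∈-exchange⁻ g∈
      ... | inj₁ (g∈C , _) = g , g∈C , end
      vertex-of-C (g , g∈ , inj₁ refl) | inj₂ refl = sf∈C
      vertex-of-C (g , g∈ , inj₂ refl) | inj₂ refl = e , e∈C , inj₂ (sym tf≡te)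
      in-edge′ : ∀ v → InV D (exchange C e f) v → ∃[ g ] (g ∈ exchange C e f × t g ≡ v)
      in-edge′ v v∈ with v ≟ᶠ t e | in-edge in₁ (vertex-of-C v∈)
      ... | yes refl | _              = f , y∈exchange , tf≡te
      ... | no  v≢te | g , g∈C , refl = g , ∈-exchange⁺ g∈C (λ { refl → v≢te refl }) , refl

    exchange-acyclic : ¬ InV D C (s f) → ∀ {Z} → IsDirCycle D Z → ¬ Z ⊆ exchange C e f
    exchange-acyclic sf∉C {Z} cycZ Z⊆ = x∉exchange (proj₁ conflict ∘ sym) (Z⊆ (cycle-minimal cyc cycZ Z⊆C e∈C))
      where
      f∉Z : f ∉ Z
      f∉Z f∈Z with in-edge (cycle⇒InDegOne cycZ) (f , f∈Z , inj₁ refl)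
      ... | g , g∈Z , tg≡sf with ∈-exchange⁻ (Z⊆ g∈Z)
      ...   | inj₁ (g∈C , _) = sf∉C (g , g∈C , inj₂ tg≡sf)
      ...   | inj₂ refl      = sf∉C (e , e∈C , inj₂ (trans (sym tf≡te) tg≡sf))
      Z⊆C : Z ⊆ C
      Z⊆C g∈Z with ∈-exchange⁻ (Z⊆ g∈Z)
      ... | inj₁ (g∈C , _) = g∈C
      ... | inj₂ refl      = ⊥-elim (f∉Z g∈Z)

    exchange-¬HyperedgeIn : ¬ InV D C (s f) → ¬ HyperedgeIn (exchange C e f)
    exchange-¬HyperedgeIn sf∉C (h , H , h⊆) with hyperedge⇒cycle⊎headConflict H
    ... | inj₁ cyc′ = exchange-acyclic sf∉C cyc′ h⊆
    ... | inj₂ (a , b , (a≢b , ta≡tb) , refl) =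
      a≢b (exchange-in-unique (h⊆ (x∈⁅x⁆∪⁅y⁆ a b)) (h⊆ (y∈⁅x⁆∪⁅y⁆ a b)) ta≡tb)

    exchange-HyperedgeIn : InV D C (s f) → HyperedgeIn (exchange C e f)
    exchange-HyperedgeIn sf∈C = cycle-HyperedgeIn (InDegOne⇒cycle (exchange-InDegOne sf∈C) (f , y∈exchange))
      where
      cycle-HyperedgeIn : ∃[ Z ] (Z ⊆ exchange C e f × IsDirCycle D Z) → HyperedgeIn (exchange C e f)
      cycle-HyperedgeIn (Z , Z⊆ , cycZ) = Z , inj₁ cycZ , Z⊆

  simplicial⇒tail-on-cycle : ∀ {e f C} → SimplicialEdge D e → IsDirCycle D C → e ∈ C →
                             HeadConflict e f → InV D C (s f)
  simplicial⇒tail-on-cycle {e} {f} {C} simplicial cyc e∈C (_ , te≡tf) with s e ≟ᶠ s f | InV? C (s f)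
  ... | yes se≡sf | _         = e , e∈C , inj₁ se≡sf
  ... | no  _     | yes sf∈C  = sf∈C
  ... | no  se≢sf | no  sf∉C  = ⊥-elim (simplicial (f , te≡tf , se≢sf , C , e∈C , cyc , sf∉C))

  two-pairs⇒HyperedgeIn : ∀ {e f₁ f₂} → f₁ ≢ f₂ → HeadConflict e f₁ → HeadConflict e f₂ →
                          HyperedgeIn (((⁅ e ⁆ ∪ ⁅ f₁ ⁆) ∪ (⁅ e ⁆ ∪ ⁅ f₂ ⁆)) - e)
  two-pairs⇒HyperedgeIn {e} {f₁} {f₂} f₁≢f₂ (e≢f₁ , te≡tf₁) (e≢f₂ , te≡tf₂) =
    headConflict⇒HyperedgeIn (f₁≢f₂ , trans (sym te≡tf₁) te≡tf₂)
      (x∈p∪q∧x≢y⇒x∈p∪q-y (inj₁ (y∈⁅x⁆∪⁅y⁆ e f₁)) (e≢f₁ ∘ sym))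
      (x∈p∪q∧x≢y⇒x∈p∪q-y (inj₂ (y∈⁅x⁆∪⁅y⁆ e f₂)) (e≢f₂ ∘ sym))

  two-cycles⇒HyperedgeIn : ∀ {e C₁ C₂} → C₁ ≢ C₂ → IsDirCycle D C₁ → IsDirCycle D C₂ →
                           e ∈ C₁ → e ∈ C₂ → HyperedgeIn ((C₁ ∪ C₂) - e)
  two-cycles⇒HyperedgeIn {e} C₁≢C₂ cyc₁ cyc₂ e∈C₁ e∈C₂
    with distinct-cycles⇒headConflict cyc₁ cyc₂ C₁≢C₂ (e , e∈C₁ , inj₂ refl) (e , e∈C₂ , inj₂ refl)
  ... | g₁ , g₂ , g₁∈C₁ , g₂∈C₂ , (g₁≢g₂ , tg₁≡tg₂) =
    headConflict⇒HyperedgeIn (g₁≢g₂ , tg₁≡tg₂)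
      (x∈p∪q∧x≢y⇒x∈p∪q-y (inj₁ g₁∈C₁) λ { refl → g₁≢g₂ (in-unique (cycle⇒InDegOne cyc₂) e∈C₂ g₂∈C₂ tg₁≡tg₂) })
      (x∈p∪q∧x≢y⇒x∈p∪q-y (inj₂ g₂∈C₂) λ { refl → g₁≢g₂ (in-unique (cycle⇒InDegOne cyc₁) g₁∈C₁ e∈C₁ tg₁≡tg₂) })

  cycle∪pair⇒HyperedgeIn : ∀ {e f C} → SimplicialEdge D e → IsDirCycle D C → e ∈ C → HeadConflict e f →
                           HyperedgeIn ((C ∪ (⁅ e ⁆ ∪ ⁅ f ⁆)) - e)
  cycle∪pair⇒HyperedgeIn simplicial cyc e∈C conflict =
    subst HyperedgeIn (sym (p∪⁅x⁆∪⁅y⁆-x≡exchange (proj₁ conflict ∘ sym)))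
      (Exchange.exchange-HyperedgeIn cyc e∈C conflict
        (simplicial⇒tail-on-cycle simplicial cyc e∈C conflict))

  simplicial⇒simplicialVertex : ∀ {e} → SimplicialEdge D e → SimplicialVertexOf (TreeConflictHyperedge D) e
  simplicial⇒simplicialVertex {e} simplicial h₁ h₂ H₁ H₂ h₁≢h₂ e∈h₁ e∈h₂
    with hyperedge-through H₁ e∈h₁ | hyperedge-through H₂ e∈h₂
  ... | inj₁ cyc₁ | inj₁ cyc₂ = two-cycles⇒HyperedgeIn h₁≢h₂ cyc₁ cyc₂ e∈h₁ e∈h₂
  ... | inj₁ cyc₁ | inj₂ (f , conflict , refl) = cycle∪pair⇒HyperedgeIn simplicial cyc₁ e∈h₁ conflict
  ... | inj₂ (f , conflict , refl) | inj₁ cyc₂ =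
    subst (λ q → HyperedgeIn (q - e)) (∪-comm h₂ _) (cycle∪pair⇒HyperedgeIn simplicial cyc₂ e∈h₂ conflict)
  ... | inj₂ (f₁ , conflict₁ , refl) | inj₂ (f₂ , conflict₂ , refl) =
    two-pairs⇒HyperedgeIn (λ { refl → h₁≢h₂ refl }) conflict₁ conflict₂

  simplicialVertex⇒simplicial : ∀ {e} → SimplicialVertexOf (TreeConflictHyperedge D) e → SimplicialEdge D e
  simplicialVertex⇒simplicial {e} simplicialVertex (f , te≡tf , se≢sf , C , e∈C , cyc , sf∉C) =
    exchange-¬HyperedgeIn sf∉C (subst HyperedgeIn (p∪⁅x⁆∪⁅y⁆-x≡exchange (e≢f ∘ sym))
      (simplicialVertex C (⁅ e ⁆ ∪ ⁅ f ⁆) (inj₁ cyc) (headConflict⇒hyperedge conflict) C≢⁅e⁆∪⁅f⁆ e∈C (x∈⁅x⁆∪⁅y⁆ e f)))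
    where
    e≢f : e ≢ f
    e≢f refl = se≢sf refl
    conflict : HeadConflict e f
    conflict = e≢f , te≡tf
    open Exchange cyc e∈C conflict
    C≢⁅e⁆∪⁅f⁆ : C ≢ ⁅ e ⁆ ∪ ⁅ f ⁆
    C≢⁅e⁆∪⁅f⁆ refl = sf∉C (f , y∈⁅x⁆∪⁅y⁆ e f , inj₁ refl)

lemma5p9 : (D : Multidigraph) (e : Edge D) →
    SimplicialEdge D e ⇔ SimplicialVertexOf (TreeConflictHyperedge D) e
lemma5p9 D e = mk⇔ (simplicial⇒simplicialVertex D) (simplicialVertex⇒simplicial D)
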